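{- Let $n$ be a power of two, and consider the complete balanced binary tree whose $n-1$ nodes are numbered $1,\dots,n-1$ in symmetric (in-order) order. Let $j<i$ be two nodes of this tree and let $k=\mathrm{LCA}_{BT}(j,i)$ be their lowest common ancestor. Then $i-j+1\le 2^{1+\rho(k)}$ and $i-k+1\le 2^{\rho(k)}$.
   Context: Because the nodes are numbered in symmetric order, node $1$ is the leftmost leaf and node $n-1$ the rightmost. For a positive integer $m$, $\rho(m)$ denotes the position of the rightmost nonzero bit in the binary representation of $m$, counting from $0$. In this tree, $\rho(m)$ is the height of node $m$. -}

module Defs where

open import Data.Nat using (ℕ; zero; suc; _+_; _^_; ⌊_/2⌋)
open import Data.Nat.Base using (_%_)
open import Data.Bool using (Bool; true; false; if_then_else_)
open import Data.Product using (Σ; _×_; ∃)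
open import Relation.Binary.PropositionalEquality using (_≡_)

data Tree : Set where
  leaf : Tree
  node : Tree → ℕ → Tree → Tree

-- The complete balanced binary tree of height h whose 2^h - 1 nodes are
-- numbered o+1, ..., o+2^h-1 in symmetric (in-order) order.
cbt : ℕ → ℕ → Tree
cbt zero    o = leaf
cbt (suc h) o = node (cbt h o) (o + 2 ^ h) (cbt h (o + 2 ^ h))

-- The tree of the paper for n = 2^h: nodes 1, ..., n-1 in symmetric order.
BT : ℕ → Tree
BT h = cbt h 0

data _∈T_ (x : ℕ) : Tree → Set where
  here  : ∀ {l r} → x ∈T node l x r
  left  : ∀ {l y r} → x ∈T l → x ∈T node l y r
  right : ∀ {l y r} → x ∈T r → x ∈T node l y r

data _⊑_ (s : Tree) : Tree → Set where
  refl⊑  : s ⊑ s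
  left⊑  : ∀ {l y r} → s ⊑ l → s ⊑ node l y r
  right⊑ : ∀ {l y r} → s ⊑ r → s ⊑ node l y r

-- In tree t, node a is an ancestor of node b (every node is an ancestor of itself).
Anc : Tree → ℕ → ℕ → Set
Anc t a b = Σ Tree λ l → Σ Tree λ r → (node l a r ⊑ t) × (b ∈T node l a r)

IsLCA : Tree → ℕ → ℕ → ℕ → Set
IsLCA t j i k = Anc t k j × Anc t k i × (∀ k' → Anc t k' j → Anc t k' i → Anc t k' k)

-- ρ(m): position (from 0) of the rightmost nonzero bit of the binary
-- representation of m (meaningful for m ≥ 1).  Fuel m suffices for m ≥ 1.
ρ-aux : ℕ → ℕ → ℕ
ρ-aux zero    m = zero
ρ-aux (suc f) m with m % 2
... | zero  = suc (ρ-aux f ⌊ m /2⌋)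
... | suc _ = zero

ρ : ℕ → ℕ
ρ m = ρ-aux m m

-- The subtree rooted at k has height g + 1 for some g, its labels form an interval of
-- width 2^(g+1) centred at k, and its offset is a multiple of 2^(g+1), so k is an odd
-- multiple of 2^g and ρ k ≥ g.  Hence every descendant x of k satisfies |x - k| < 2^ρ(k),
-- and applying this to i and to j gives both bounds.
module Submission where

open import Defs
open import Data.Nat using (ℕ; zero; suc; _+_; _*_; _^_; _≤_; _<_; ⌊_/2⌋; _%_; NonZero; z≤n; s≤s)
open import Data.Nat.Properties
open import Data.Nat.DivMod using (m*n%n≡0)
open import Data.Nat.Tactic.RingSolver using (solve-∀)
open import Data.Product using (_×_; _,_; proj₁; proj₂; ∃₂)
open import Relation.Binary.PropositionalEquality using (_≡_; refl; sym; trans; cong; subst)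

n<2^n : ∀ n → n < 2 ^ n
n<2^n zero    = s≤s z≤n
n<2^n (suc n) = +-mono-≤ (m^n>0 2 n) (≤-trans (n<2^n n) (m≤m+n (2 ^ n) 0))

⌊n*2/2⌋≡n : ∀ n → ⌊ n * 2 /2⌋ ≡ n
⌊n*2/2⌋≡n zero    = refl
⌊n*2/2⌋≡n (suc n) = cong suc (⌊n*2/2⌋≡n n)

n*2%2≡0 : ∀ n → n * 2 % 2 ≡ 0
n*2%2≡0 n = m*n%n≡0 n 2

ρ-aux-*2 : ∀ f m → ρ-aux (suc f) (m * 2) ≡ suc (ρ-aux f m)
ρ-aux-*2 f m rewrite n*2%2≡0 m | ⌊n*2/2⌋≡n m = refl

ρ-aux-2^* : ∀ {g f} m → g ≤ f → g ≤ ρ-aux f (2 ^ g * m)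
ρ-aux-2^* {zero}          m _         = z≤n
ρ-aux-2^* {suc g} {suc f} m (s≤s g≤f)
  rewrite *-assoc 2 (2 ^ g) m | *-comm 2 (2 ^ g * m) | ρ-aux-*2 f (2 ^ g * m)
  = s≤s (ρ-aux-2^* m g≤f)

ρ-2^* : ∀ g m .{{_ : NonZero m}} → g ≤ ρ (2 ^ g * m)
ρ-2^* g m = ρ-aux-2^* m (≤-trans (<⇒≤ (n<2^n g)) (m≤m*n (2 ^ g) m))

m+2^n+2^n≡m+2^[1+n] : ∀ m n → m + 2 ^ n + 2 ^ n ≡ m + 2 ^ suc n
m+2^n+2^n≡m+2^[1+n] m n =
  trans (+-assoc m (2 ^ n) (2 ^ n)) (cong (λ t → m + (2 ^ n + t)) (sym (+-identityʳ (2 ^ n))))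

∈cbt⇒bounds : ∀ {x} h o → x ∈T cbt h o → o < x × x < o + 2 ^ h
∈cbt⇒bounds (suc h) o here =
  m<m+n o (m^n>0 2 h) , subst (o + 2 ^ h <_) (m+2^n+2^n≡m+2^[1+n] o h) (m<m+n (o + 2 ^ h) (m^n>0 2 h))
∈cbt⇒bounds (suc h) o (left p) with ∈cbt⇒bounds h o p
... | o<x , x<o+2^h = o<x , <-≤-trans x<o+2^h (+-monoʳ-≤ o (m≤m+n (2 ^ h) _))
∈cbt⇒bounds {x} (suc h) o (right p) with ∈cbt⇒bounds h (o + 2 ^ h) p
... | o+2^h<x , x<o+2^h+2^h =
  <-trans (m<m+n o (m^n>0 2 h)) o+2^h<x , subst (x <_) (m+2^n+2^n≡m+2^[1+n] o h) x<o+2^h+2^h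

c*[2*p]+p≡[1+c*2]*p : ∀ c p → c * (2 * p) + p ≡ (1 + c * 2) * p
c*[2*p]+p≡[1+c*2]*p = solve-∀

g≤ρ[c*2^[1+g]+2^g] : ∀ g c → g ≤ ρ (c * 2 ^ suc g + 2 ^ g)
g≤ρ[c*2^[1+g]+2^g] g c rewrite c*[2*p]+p≡[1+c*2]*p c (2 ^ g) | *-comm (1 + c * 2) (2 ^ g) =
  ρ-2^* g (1 + c * 2)

⊑cbt-aligned : ∀ {s} h c → s ⊑ cbt h (c * 2 ^ h) → ∃₂ λ g c′ → s ≡ cbt g (c′ * 2 ^ g)
⊑cbt-aligned zero    c refl⊑ = zero , c , refl
⊑cbt-aligned (suc h) c refl⊑ = suc h , c , refl
⊑cbt-aligned {s} (suc h) c (left⊑ p) =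
  ⊑cbt-aligned h (c * 2) (subst (λ o → s ⊑ cbt h o) (sym (*-assoc c 2 (2 ^ h))) p)
⊑cbt-aligned {s} (suc h) c (right⊑ p) =
  ⊑cbt-aligned h (1 + c * 2) (subst (λ o → s ⊑ cbt h o) (c*[2*p]+p≡[1+c*2]*p c (2 ^ h)) p)

Anc-BT⇒close : ∀ {h k x} → Anc (BT h) k x → k < x + 2 ^ ρ k × x < k + 2 ^ ρ k
Anc-BT⇒close {h} {k} {x} (l , r , k⊑BT , x∈k) with ⊑cbt-aligned h 0 k⊑BT
... | suc g , c , refl with ∈cbt⇒bounds (suc g) (c * 2 ^ suc g) x∈k
... | o<x , x<o+2^[1+g] =
    <-≤-trans (+-monoˡ-< (2 ^ g) o<x) (+-monoʳ-≤ x 2^g≤2^ρk)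
  , <-≤-trans (subst (x <_) (sym (m+2^n+2^n≡m+2^[1+n] (c * 2 ^ suc g) g)) x<o+2^[1+g])
              (+-monoʳ-≤ k 2^g≤2^ρk)
  where
  2^g≤2^ρk : 2 ^ g ≤ 2 ^ ρ k
  2^g≤2^ρk = ^-monoʳ-≤ 2 (g≤ρ[c*2^[1+g]+2^g] g c)

lemma1 : ∀ (h j i k : ℕ) → j ∈T BT h → i ∈T BT h → j < i → IsLCA (BT h) j i k →
           (i + 1 ≤ j + 2 ^ (1 + ρ k)) × (i + 1 ≤ k + 2 ^ ρ k)
lemma1 h j i k _ _ _ (k-anc-j , k-anc-i , _) = i+1≤j+2^[1+ρk] , i+1≤k+2^ρk
  where
  open ≤-Reasoning

  i+1≤k+2^ρk : i + 1 ≤ k + 2 ^ ρ k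
  i+1≤k+2^ρk = subst (_≤ k + 2 ^ ρ k) (+-comm 1 i) (proj₂ (Anc-BT⇒close k-anc-i))

  i+1≤j+2^[1+ρk] : i + 1 ≤ j + 2 ^ (1 + ρ k)
  i+1≤j+2^[1+ρk] = begin
    i + 1                   ≤⟨ i+1≤k+2^ρk ⟩
    k + 2 ^ ρ k             ≤⟨ +-monoˡ-≤ (2 ^ ρ k) (<⇒≤ (proj₁ (Anc-BT⇒close k-anc-j))) ⟩
    j + 2 ^ ρ k + 2 ^ ρ k   ≡⟨ m+2^n+2^n≡m+2^[1+n] j (ρ k) ⟩
    j + 2 ^ (1 + ρ k)       ∎
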